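{- Let $p,q$ be positive coprime integers. Then $$\sum_{r=1}^{q-1}\sum_{t<\frac{rp}{q}}t=\frac{(p-1)(2pq-3p+2q)}{12}+p\,s(q,p),$$ where for each $r$ the inner sum runs over all positive integers $t$ with $t<\frac{rp}{q}$.
   Context: For a real number $x$, $\{x\}=x-\lfloor x\rfloor$ is the fractional part. The normalized first Bernoulli function is $B_1(x)=\{x\}-\frac12$ if $x\notin\mathbb{Z}$ and $B_1(x)=0$ if $x\in\mathbb{Z}$. For an integer $h$ and a positive integer $k$, $s(h,k)=\sum_{r=1}^{k-1}B_1\left(\frac{r}{k}\right)B_1\left(\frac{rh}{k}\right)$. -}

module Defs where

open import Data.Nat as ℕ using (ℕ; zero; suc; NonZero)
open import Data.Integer as ℤ using (ℤ; +_)
open import Data.Rational using (ℚ; _/_; _+_; _-_; _*_; floor; 0ℚ; ½; _≟_)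
open import Relation.Nullary using (yes; no)

frac : ℚ → ℚ
frac x = x - (floor x / 1)

B₁ : ℚ → ℚ
B₁ x with frac x ≟ 0ℚ
... | yes _ = 0ℚ
... | no  _ = frac x - ½

-- Σ_{i = a}^{a + n - 1} f i   (n terms starting at a)
sumFrom : ℕ → ℕ → (ℕ → ℚ) → ℚ
sumFrom a zero    f = 0ℚ
sumFrom a (suc n) f = f a + sumFrom (suc a) n f

-- Σ_{i = a}^{b} f i  (empty if b < a)
sumFromTo : ℕ → ℕ → (ℕ → ℚ) → ℚ
sumFromTo a b f = sumFrom a (suc b ℕ.∸ a) f

dedekind : ℤ → (k : ℕ) → .{{NonZero k}} → ℚ
dedekind h k = sumFromTo 1 (k ℕ.∸ 1) (λ r → B₁ (+ r / k) * B₁ ((+ r ℤ.* h) / k))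

{-# OPTIONS --safe #-}
-- Write tq = res t + p ⌊tq/p⌋ with 0 ≤ res t < p.  Counting the left-hand side L by columns, each
-- 0 < t < p is summed in exactly q − 1 − ⌊tq/p⌋ rows.  On the other side
-- 4p² s(q,p) = Σ_t (2t − p)(2 res t − p), and substituting res t = tq − p ⌊tq/p⌋ makes the floors
-- cancel: 12p L − 12p² s(q,p) is a sum of a quadratic polynomial in t plus 6p Σ_t (res t − t).
-- Coprimality gives res (p − t) + res t = p, hence Σ_t res t = Σ_t t, and the power sums Σ t and
-- Σ t² evaluate the rest to p (p − 1)(2pq − 3p + 2q).
module Submission where

open import Defs
open import Data.Nat as ℕ using (ℕ; NonZero; _<ᵇ_)
open import Data.Nat.Coprimality using (Coprime)
open import Data.Integer as ℤ using (+_)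
open import Data.Rational using (ℚ; _/_; _+_; _*_; 0ℚ)
open import Data.Bool using (if_then_else_)
open import Relation.Binary.PropositionalEquality using (_≡_)

open import Data.Bool using (true; false; T)
open import Data.Bool.Properties using (if-float)
open import Data.Integer using (ℤ; -[1+_])
import Data.Integer.GCD as ℤG
import Data.Integer.Properties as ℤP
open import Data.Integer.Tactic.RingSolver using (solve-∀)
open import Data.Nat using (zero; suc; _≤_; _<_; s≤s; z≤n; _∸_; _%_)
import Data.Nat.Coprimality as ℕC
open import Data.Nat.Divisibility using (_∣_; divides)
import Data.Nat.Divisibility as ℕDv
import Data.Nat.DivMod as ℕD
import Data.Nat.GCD as ℕG
import Data.Nat.Properties as ℕP
open import Data.Rational using (mkℚ; _-_; -_; 1ℚ; ½; floor; _≟_; ↥_; ↧_)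
import Data.Rational.Properties as ℚP
import Data.Rational.Solver as ℚS
import Data.Rational.Unnormalised as ℚᵘ
open import Data.Unit using (tt)
open import Function using (_∘_)
open import Relation.Binary.PropositionalEquality using (refl; sym; trans; cong; cong₂; subst; _≢_; module ≡-Reasoning)
open import Relation.Nullary using (yes; no; contradiction)
open import Algebra.Properties.AbelianGroup ℤP.+-0-abelianGroup using (∙-cancelʳ)
open import Algebra.Properties.CommutativeSemigroup ℤP.+-commutativeSemigroup
  using () renaming (interchange to +-interchange)

fromℤ : ℤ → ℚ
fromℤ i = i / 1

-- i / n normalises through gcd, which is stuck on variables; ℚ arithmetic computes on these records.
private
  mkℚ/1 : ℤ → ℚ
  mkℚ/1 i = mkℚ i 0 (ℕC.sym (ℕC.1-coprimeTo _))

  fromℤ≡mkℚ : ∀ i → fromℤ i ≡ mkℚ/1 i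
  fromℤ≡mkℚ i = ℚP.↥p/↧p≡p (mkℚ/1 i)

  1/n≡mkℚ : ∀ n .{{_ : NonZero n}} → + 1 / n ≡ mkℚ (+ 1) (ℕ.pred n) (ℕC.1-coprimeTo _)
  1/n≡mkℚ (suc n) = ℚP.↥p/↧p≡p (mkℚ (+ 1) n _)

fromℤ-homo-* : ∀ i j → fromℤ (i ℤ.* j) ≡ fromℤ i * fromℤ j
fromℤ-homo-* i j = sym (cong₂ _*_ (fromℤ≡mkℚ i) (fromℤ≡mkℚ j))

fromℤ-homo-+ : ∀ i j → fromℤ (i ℤ.+ j) ≡ fromℤ i + fromℤ j
fromℤ-homo-+ i j = sym (trans (cong₂ _+_ (fromℤ≡mkℚ i) (fromℤ≡mkℚ j))
  (ℚP./-cong (cong₂ ℤ._+_ (ℤP.*-identityʳ i) (ℤP.*-identityʳ j)) refl))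

fromℤ-homo‿- : ∀ i → fromℤ (ℤ.- i) ≡ - fromℤ i
fromℤ-homo‿- i = trans (fromℤ≡mkℚ (ℤ.- i)) (trans (neg-mkℚ i) (cong -_ (sym (fromℤ≡mkℚ i))))
  where
  neg-mkℚ : ∀ i → mkℚ/1 (ℤ.- i) ≡ - mkℚ/1 i
  neg-mkℚ (+ zero)  = refl
  neg-mkℚ (+ suc n) = refl
  neg-mkℚ -[1+ n ]  = refl

fromℤ-homo-- : ∀ i j → fromℤ (i ℤ.- j) ≡ fromℤ i - fromℤ j
fromℤ-homo-- i j = trans (fromℤ-homo-+ i (ℤ.- j)) (cong (λ x → fromℤ i + x) (fromℤ-homo‿- j))

i/n≡i*1/n : ∀ i n .{{_ : NonZero n}} → i / n ≡ fromℤ i * (+ 1 / n)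
i/n≡i*1/n i n@(suc _) = sym (trans (cong₂ _*_ (fromℤ≡mkℚ i) (1/n≡mkℚ n))
  (ℚP./-cong (ℤP.*-identityʳ i) (ℕP.*-identityˡ n)))

n*1/n≡1 : ∀ n .{{_ : NonZero n}} → fromℤ (+ n) * (+ 1 / n) ≡ 1ℚ
n*1/n≡1 n@(suc _) = trans (sym (i/n≡i*1/n (+ n) n)) n/n≡1
  where
  n/n≡1 : + n / n ≡ 1ℚ
  n/n≡1 = ℚP.fromℚᵘ-cong {ℚᵘ.mkℚᵘ (+ n) (ℕ.pred n)} {ℚᵘ.mkℚᵘ (+ 1) 0} (ℚᵘ.*≡* (trans (ℤP.*-identityʳ (+ n)) (sym (ℤP.*-identityˡ (+ n)))))

floor-/ : ∀ m n .{{_ : NonZero n}} → floor (+ m / n) ≡ + (m ℕ./ n)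
floor-/ m n@(suc _) = floor-scaled (+ m / n) (ℕG.gcd m n) (ℚP.↥-/ (+ m) n) (ℚP.↧-/ (+ m) n)
  where
  floor-scaled : ∀ x g → ↥ x ℤ.* + g ≡ + m → ↧ x ℤ.* + g ≡ + n → floor x ≡ + (m ℕ./ n)
  floor-scaled (mkℚ _ d _) zero _ d*0≡n with trans (sym d*0≡n) (ℤP.*-zeroʳ (+ suc d))
  ... | ()
  floor-scaled (mkℚ -[1+ _ ] _ _) (suc _) () _
  floor-scaled (mkℚ (+ a) d _) g@(suc _) a*g≡m d*g≡n = trans (ℤP.*-identityˡ _) (cong +_ (begin
    a ℕ./ suc d                   ≡⟨ ℕD.m*n/o*n≡m/o a g (suc d) ⟨
    (a ℕ.* g) ℕ./ (suc d ℕ.* g)   ≡⟨ ℕD./-congˡ (ℤP.+-injective (trans (ℤP.pos-* a g) a*g≡m)) ⟩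
    m ℕ./ (suc d ℕ.* g)           ≡⟨ ℕD./-congʳ {m = m} (ℤP.+-injective (trans (ℤP.pos-* (suc d) g) d*g≡n)) ⟩
    m ℕ./ n                       ∎))
    where open ≡-Reasoning

frac-/ : ∀ m n .{{_ : NonZero n}} → frac (+ m / n) ≡ + (m % n) / n
frac-/ m n = begin
  + m / n - fromℤ (floor (+ m / n))
    ≡⟨ cong₂ (λ x y → x - fromℤ y) (i/n≡i*1/n (+ m) n) (floor-/ m n) ⟩
  fromℤ (+ m) * w - b
    ≡⟨ cong (λ x → x * w - b) m≡r+b*N ⟩
  (r + b * N) * w - b
    ≡⟨ solve 4 (λ r b N w → (r :+ b :* N) :* w :- b := r :* w :+ b :* (N :* w) :- b) refl r b N w ⟩
  r * w + b * (N * w) - b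
    ≡⟨ cong (λ x → r * w + b * x - b) (n*1/n≡1 n) ⟩
  r * w + b * 1ℚ - b
    ≡⟨ solve 3 (λ r b w → r :* w :+ b :* con 1ℚ :- b := r :* w) refl r b w ⟩
  r * w
    ≡⟨ i/n≡i*1/n (+ (m % n)) n ⟨
  + (m % n) / n ∎
  where
  open ≡-Reasoning
  open ℚS.+-*-Solver
  w = + 1 / n
  N = fromℤ (+ n)
  r = fromℤ (+ (m % n))
  b = fromℤ (+ (m ℕ./ n))
  m≡r+b*N : fromℤ (+ m) ≡ r + b * N
  m≡r+b*N = begin
    fromℤ (+ m)                                 ≡⟨ cong (fromℤ ∘ +_) (ℕD.m≡m%n+[m/n]*n m n) ⟩
    fromℤ (+ (m % n) ℤ.+ + (m ℕ./ n ℕ.* n))     ≡⟨ cong (λ x → fromℤ (+ (m % n) ℤ.+ x)) (ℤP.pos-* (m ℕ./ n) n) ⟩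
    fromℤ (+ (m % n) ℤ.+ + (m ℕ./ n) ℤ.* + n)   ≡⟨ fromℤ-homo-+ (+ (m % n)) (+ (m ℕ./ n) ℤ.* + n) ⟩
    r + fromℤ (+ (m ℕ./ n) ℤ.* + n)             ≡⟨ cong (λ x → r + x) (fromℤ-homo-* (+ (m ℕ./ n)) (+ n)) ⟩
    r + b * N                                   ∎

/-≢0 : ∀ m n .{{_ : NonZero n}} → m ≢ 0 → + m / n ≢ 0ℚ
/-≢0 m n m≢0 m/n≡0 = m≢0 (ℤP.+-injective (begin
  + m                                   ≡⟨ ℚP.↥-/ (+ m) n ⟨
  ↥ (+ m / n) ℤ.* ℤG.gcd (+ m) (+ n)    ≡⟨ cong (ℤ._* ℤG.gcd (+ m) (+ n)) (ℚP.p≡0⇒↥p≡0 (+ m / n) m/n≡0) ⟩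
  + 0 ℤ.* ℤG.gcd (+ m) (+ n)            ≡⟨ ℤP.*-zeroˡ (ℤG.gcd (+ m) (+ n)) ⟩
  + 0                                   ∎))
  where open ≡-Reasoning

B₁-/ : ∀ m n .{{_ : NonZero n}} → m % n ≢ 0 → B₁ (+ m / n) ≡ + (m % n) / n - ½
B₁-/ m n r≢0 with frac (+ m / n) ≟ 0ℚ
... | yes frac≡0 = contradiction (trans (sym (frac-/ m n)) frac≡0) (/-≢0 (m % n) n r≢0)
... | no _       = cong (_- ½) (frac-/ m n)

Σℤ : ℕ → ℕ → (ℕ → ℤ) → ℤ
Σℤ a zero    f = + 0
Σℤ a (suc n) f = f a ℤ.+ Σℤ (suc a) n f

Σℤ-cong : ∀ a n {f g : ℕ → ℤ} → (∀ i → a ≤ i → i < a ℕ.+ n → f i ≡ g i) → Σℤ a n f ≡ Σℤ a n g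
Σℤ-cong a zero    f≗g = refl
Σℤ-cong a (suc n) f≗g = cong₂ ℤ._+_ (f≗g a ℕP.≤-refl (ℕP.m<m+n a (s≤s z≤n)))
  (Σℤ-cong (suc a) n (λ i a<i i<a+1+n → f≗g i (ℕP.<⇒≤ a<i) (ℕP.<-≤-trans i<a+1+n (ℕP.≤-reflexive (sym (ℕP.+-suc a n))))))

Σℤ-++ : ∀ a m n f → Σℤ a (m ℕ.+ n) f ≡ Σℤ a m f ℤ.+ Σℤ (a ℕ.+ m) n f
Σℤ-++ a zero    n f = trans (cong (λ b → Σℤ b n f) (sym (ℕP.+-identityʳ a))) (sym (ℤP.+-identityˡ _))
Σℤ-++ a (suc m) n f = trans (cong (ℤ._+_ (f a)) (trans (Σℤ-++ (suc a) m n f)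
  (cong (λ b → Σℤ (suc a) m f ℤ.+ Σℤ b n f) (sym (ℕP.+-suc a m))))) (sym (ℤP.+-assoc (f a) _ _))

Σℤ-const : ∀ a n c → Σℤ a n (λ _ → c) ≡ + n ℤ.* c
Σℤ-const a zero    c = sym (ℤP.*-zeroˡ c)
Σℤ-const a (suc n) c = trans (cong (ℤ._+_ c) (Σℤ-const (suc a) n c)) (sym (ℤP.suc-* (+ n) c))

Σℤ-+ : ∀ a n f g → Σℤ a n (λ i → f i ℤ.+ g i) ≡ Σℤ a n f ℤ.+ Σℤ a n g
Σℤ-+ a zero    f g = refl
Σℤ-+ a (suc n) f g = trans (cong (ℤ._+_ (f a ℤ.+ g a)) (Σℤ-+ (suc a) n f g))
  (+-interchange (f a) (g a) (Σℤ (suc a) n f) (Σℤ (suc a) n g))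

Σℤ-*ˡ : ∀ a n c f → Σℤ a n (λ i → c ℤ.* f i) ≡ c ℤ.* Σℤ a n f
Σℤ-*ˡ a zero    c f = sym (ℤP.*-zeroʳ c)
Σℤ-*ˡ a (suc n) c f = trans (cong (ℤ._+_ (c ℤ.* f a)) (Σℤ-*ˡ (suc a) n c f)) (sym (ℤP.*-distribˡ-+ c (f a) _))

Σℤ-swap : ∀ a m b n (f : ℕ → ℕ → ℤ) → Σℤ a m (λ i → Σℤ b n (f i)) ≡ Σℤ b n (λ j → Σℤ a m (λ i → f i j))
Σℤ-swap a zero    b n f = sym (trans (Σℤ-const b n (+ 0)) (ℤP.*-zeroʳ (+ n)))
Σℤ-swap a (suc m) b n f = trans (cong (ℤ._+_ (Σℤ b n (f a))) (Σℤ-swap (suc a) m b n f))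
  (sym (Σℤ-+ b n (f a) (λ j → Σℤ (suc a) m (λ i → f i j))))

Σℤ-shift : ∀ a n f → Σℤ (suc a) n f ≡ Σℤ a n (f ∘ suc)
Σℤ-shift a zero    f = refl
Σℤ-shift a (suc n) f = cong (ℤ._+_ (f (suc a))) (Σℤ-shift (suc a) n f)

Σℤ-last : ∀ a n f → Σℤ a (suc n) f ≡ Σℤ a n f ℤ.+ f (a ℕ.+ n)
Σℤ-last a n f = begin
  Σℤ a (suc n) f                    ≡⟨ cong (λ m → Σℤ a m f) (ℕP.+-comm 1 n) ⟩
  Σℤ a (n ℕ.+ 1) f                  ≡⟨ Σℤ-++ a n 1 f ⟩
  Σℤ a n f ℤ.+ (f (a ℕ.+ n) ℤ.+ + 0) ≡⟨ cong (ℤ._+_ (Σℤ a n f)) (ℤP.+-identityʳ _) ⟩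
  Σℤ a n f ℤ.+ f (a ℕ.+ n)          ∎
  where open ≡-Reasoning

Σℤ-reverse : ∀ n f → Σℤ 1 n f ≡ Σℤ 1 n (λ t → f (suc n ∸ t))
Σℤ-reverse zero    f = refl
Σℤ-reverse (suc n) f = begin
  f 1 ℤ.+ Σℤ 2 n f                                   ≡⟨ cong (ℤ._+_ (f 1)) (Σℤ-shift 1 n f) ⟩
  f 1 ℤ.+ Σℤ 1 n (f ∘ suc)                           ≡⟨ cong (ℤ._+_ (f 1)) (Σℤ-reverse n (f ∘ suc)) ⟩
  f 1 ℤ.+ Σℤ 1 n (λ t → f (suc (suc n ∸ t)))         ≡⟨ cong (ℤ._+_ (f 1)) (Σℤ-cong 1 n (λ t _ t<1+n →
                                                          cong f (sym (ℕP.+-∸-assoc 1 (ℕP.<⇒≤ t<1+n))))) ⟩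
  f 1 ℤ.+ Σℤ 1 n (λ t → f (suc (suc n) ∸ t))         ≡⟨ ℤP.+-comm (f 1) _ ⟩
  Σℤ 1 n (λ t → f (suc (suc n) ∸ t)) ℤ.+ f 1         ≡⟨ cong (λ m → Σℤ 1 n (λ t → f (suc (suc n) ∸ t)) ℤ.+ f m) (sym (ℕP.m+n∸n≡m 1 n)) ⟩
  Σℤ 1 n (λ t → f (suc (suc n) ∸ t)) ℤ.+ f (suc (suc n) ∸ suc n) ≡⟨ Σℤ-last 1 n _ ⟨
  Σℤ 1 (suc n) (λ t → f (suc (suc n) ∸ t))           ∎
  where open ≡-Reasoning

Σℤ-+-*ˡ : ∀ a n f c g → Σℤ a n (λ i → f i ℤ.+ c ℤ.* g i) ≡ Σℤ a n f ℤ.+ c ℤ.* Σℤ a n g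
Σℤ-+-*ˡ a n f c g = trans (Σℤ-+ a n f (λ i → c ℤ.* g i)) (cong (ℤ._+_ (Σℤ a n f)) (Σℤ-*ˡ a n c g))

Σℤ-zero : ∀ a n {f} → (∀ i → a ≤ i → i < a ℕ.+ n → f i ≡ + 0) → Σℤ a n f ≡ + 0
Σℤ-zero a n f≗0 = trans (Σℤ-cong a n f≗0) (trans (Σℤ-const a n (+ 0)) (ℤP.*-zeroʳ (+ n)))

Σℤ-complement : ∀ n f c → (∀ t → 1 ≤ t → t < suc n → f (suc n ∸ t) ℤ.+ f t ≡ c) → + 2 ℤ.* Σℤ 1 n f ≡ + n ℤ.* c
Σℤ-complement n f c complement = begin
  + 2 ℤ.* Σℤ 1 n f                                ≡⟨ ℤP.suc-* (+ 1) (Σℤ 1 n f) ⟩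
  Σℤ 1 n f ℤ.+ + 1 ℤ.* Σℤ 1 n f                   ≡⟨ cong (ℤ._+_ (Σℤ 1 n f)) (ℤP.*-identityˡ _) ⟩
  Σℤ 1 n f ℤ.+ Σℤ 1 n f                           ≡⟨ cong (ℤ._+ Σℤ 1 n f) (Σℤ-reverse n f) ⟩
  Σℤ 1 n (λ t → f (suc n ∸ t)) ℤ.+ Σℤ 1 n f        ≡⟨ Σℤ-+ 1 n _ f ⟨
  Σℤ 1 n (λ t → f (suc n ∸ t) ℤ.+ f t)            ≡⟨ Σℤ-cong 1 n complement ⟩
  Σℤ 1 n (λ _ → c)                                ≡⟨ Σℤ-const 1 n c ⟩
  + n ℤ.* c                                       ∎
  where open ≡-Reasoning

Σℤ-quadratic : ∀ n (a b c : ℤ) →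
  Σℤ 1 n (λ t → a ℤ.* (+ 2 ℤ.* + t) ℤ.+ b ℤ.* (+ 6 ℤ.* (+ t ℤ.* + t)) ℤ.+ c)
    ≡ a ℤ.* (+ n ℤ.* (+ n ℤ.+ + 1)) ℤ.+ b ℤ.* (+ n ℤ.* (+ n ℤ.+ + 1) ℤ.* (+ 2 ℤ.* + n ℤ.+ + 1)) ℤ.+ + n ℤ.* c
Σℤ-quadratic zero    a b c = empty a b c
  where
  empty : ∀ (a b c : ℤ) →
    + 0 ≡ a ℤ.* (+ 0 ℤ.* (+ 0 ℤ.+ + 1)) ℤ.+ b ℤ.* (+ 0 ℤ.* (+ 0 ℤ.+ + 1) ℤ.* (+ 2 ℤ.* + 0 ℤ.+ + 1)) ℤ.+ + 0 ℤ.* c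
  empty = solve-∀
Σℤ-quadratic (suc n) a b c =
  trans (Σℤ-last 1 n f) (trans (cong (ℤ._+ f (suc n)) (Σℤ-quadratic n a b c)) (step a b c (+ n)))
  where
  f : ℕ → ℤ
  f t = a ℤ.* (+ 2 ℤ.* + t) ℤ.+ b ℤ.* (+ 6 ℤ.* (+ t ℤ.* + t)) ℤ.+ c
  step : ∀ (a b c N : ℤ) →
    a ℤ.* (N ℤ.* (N ℤ.+ + 1)) ℤ.+ b ℤ.* (N ℤ.* (N ℤ.+ + 1) ℤ.* (+ 2 ℤ.* N ℤ.+ + 1)) ℤ.+ N ℤ.* c
      ℤ.+ (a ℤ.* (+ 2 ℤ.* (+ 1 ℤ.+ N)) ℤ.+ b ℤ.* (+ 6 ℤ.* ((+ 1 ℤ.+ N) ℤ.* (+ 1 ℤ.+ N))) ℤ.+ c)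
    ≡ a ℤ.* ((+ 1 ℤ.+ N) ℤ.* ((+ 1 ℤ.+ N) ℤ.+ + 1)) ℤ.+ b ℤ.* ((+ 1 ℤ.+ N) ℤ.* ((+ 1 ℤ.+ N) ℤ.+ + 1) ℤ.* (+ 2 ℤ.* (+ 1 ℤ.+ N) ℤ.+ + 1))
      ℤ.+ (+ 1 ℤ.+ N) ℤ.* c
  step = solve-∀

sumFrom-cong : ∀ a n {f g : ℕ → ℚ} → (∀ i → a ≤ i → i < a ℕ.+ n → f i ≡ g i) → sumFrom a n f ≡ sumFrom a n g
sumFrom-cong a zero    f≗g = refl
sumFrom-cong a (suc n) f≗g = cong₂ _+_ (f≗g a ℕP.≤-refl (ℕP.m<m+n a (s≤s z≤n)))
  (sumFrom-cong (suc a) n (λ i a<i i<a+1+n → f≗g i (ℕP.<⇒≤ a<i) (ℕP.<-≤-trans i<a+1+n (ℕP.≤-reflexive (sym (ℕP.+-suc a n))))))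

sumFrom-*ʳ : ∀ a n f c → sumFrom a n (λ i → f i * c) ≡ sumFrom a n f * c
sumFrom-*ʳ a zero    f c = sym (ℚP.*-zeroˡ c)
sumFrom-*ʳ a (suc n) f c = trans (cong (λ x → f a * c + x) (sumFrom-*ʳ (suc a) n f c)) (sym (ℚP.*-distribʳ-+ c (f a) _))

sumFrom-fromℤ : ∀ a n f → sumFrom a n (fromℤ ∘ f) ≡ fromℤ (Σℤ a n f)
sumFrom-fromℤ a zero    f = refl
sumFrom-fromℤ a (suc n) f = trans (cong (λ x → fromℤ (f a) + x) (sumFrom-fromℤ (suc a) n f)) (sym (fromℤ-homo-+ (f a) _))

n∣m∧0<m<n+n⇒m≡n : ∀ {m n} → n ∣ m → 0 < m → m < n ℕ.+ n → m ≡ n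
n∣m∧0<m<n+n⇒m≡n (divides zero refl)          ()  _
n∣m∧0<m<n+n⇒m≡n {n = n} (divides 1 refl)      _   _     = ℕP.+-identityʳ n
n∣m∧0<m<n+n⇒m≡n {n = n} (divides (suc (suc j)) refl) _ m<n+n =
  contradiction m<n+n (ℕP.≤⇒≯ (ℕP.+-monoʳ-≤ n (ℕP.m≤m+n n (j ℕ.* n))))

-- lhs − rhs = 12p (C + t f − k t) − 12t (m + f p − t (1 + k)), which both hypotheses make vanish.
column-identity : ∀ (p k t f m C : ℤ) →
  C ℤ.+ t ℤ.* f ≡ k ℤ.* t → t ℤ.* (+ 1 ℤ.+ k) ≡ m ℤ.+ f ℤ.* p →
  + 12 ℤ.* p ℤ.* C ℤ.+ + 6 ℤ.* p ℤ.* t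
    ≡ + 3 ℤ.* ((+ 2 ℤ.* t ℤ.- p) ℤ.* (+ 2 ℤ.* m ℤ.- p))
      ℤ.+ (+ 6 ℤ.* p ℤ.* (+ 1 ℤ.+ k) ℤ.* (+ 2 ℤ.* t) ℤ.+ ℤ.- (+ 2 ℤ.* (+ 1 ℤ.+ k)) ℤ.* (+ 6 ℤ.* (t ℤ.* t)) ℤ.+ ℤ.- (+ 3 ℤ.* (p ℤ.* p)))
      ℤ.+ + 6 ℤ.* p ℤ.* m
column-identity p k t f m C count divmod = ℤP.i-j≡0⇒i≡j _ _
  (trans (combination p k t f m C)
  (trans (cong₂ (λ x y → + 12 ℤ.* p ℤ.* (x ℤ.- k ℤ.* t) ℤ.- + 12 ℤ.* t ℤ.* (y ℤ.- t ℤ.* (+ 1 ℤ.+ k))) count (sym divmod))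
         (cancel p k t)))
  where
  combination : ∀ (p k t f m C : ℤ) →
    + 12 ℤ.* p ℤ.* C ℤ.+ + 6 ℤ.* p ℤ.* t
      ℤ.- (+ 3 ℤ.* ((+ 2 ℤ.* t ℤ.- p) ℤ.* (+ 2 ℤ.* m ℤ.- p))
           ℤ.+ (+ 6 ℤ.* p ℤ.* (+ 1 ℤ.+ k) ℤ.* (+ 2 ℤ.* t) ℤ.+ ℤ.- (+ 2 ℤ.* (+ 1 ℤ.+ k)) ℤ.* (+ 6 ℤ.* (t ℤ.* t)) ℤ.+ ℤ.- (+ 3 ℤ.* (p ℤ.* p)))
           ℤ.+ + 6 ℤ.* p ℤ.* m)
    ≡ + 12 ℤ.* p ℤ.* (C ℤ.+ t ℤ.* f ℤ.- k ℤ.* t) ℤ.- + 12 ℤ.* t ℤ.* (m ℤ.+ f ℤ.* p ℤ.- t ℤ.* (+ 1 ℤ.+ k))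
  combination = solve-∀
  cancel : ∀ (p k t : ℤ) → + 12 ℤ.* p ℤ.* (k ℤ.* t ℤ.- k ℤ.* t) ℤ.- + 12 ℤ.* t ℤ.* (t ℤ.* (+ 1 ℤ.+ k) ℤ.- t ℤ.* (+ 1 ℤ.+ k)) ≡ + 0
  cancel = solve-∀

B₁-product : ∀ x y P w → P * w ≡ 1ℚ →
  (x * w - ½) * (y * w - ½) ≡ (fromℤ (+ 2) * x - P) * (fromℤ (+ 2) * y - P) * (w * w * (½ * ½))
B₁-product x y P w Pw≡1 = begin
  (x * w - ½) * (y * w - ½)
    ≡⟨ cong (λ h → (x * w - h) * (y * w - h)) (ℚP.*-identityʳ ½) ⟨
  (x * w - ½ * 1ℚ) * (y * w - ½ * 1ℚ)
    ≡⟨ cong (λ u → (x * w - ½ * u) * (y * w - ½ * u)) Pw≡1 ⟨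
  (x * w - ½ * (P * w)) * (y * w - ½ * (P * w))
    ≡⟨ solve 4 (λ x y P w → (x :* w :- con ½ :* (P :* w)) :* (y :* w :- con ½ :* (P :* w))
                       := (con (fromℤ (+ 2)) :* x :- P) :* (con (fromℤ (+ 2)) :* y :- P) :* (w :* w :* (con ½ :* con ½))) refl x y P w ⟩
  (fromℤ (+ 2) * x - P) * (fromℤ (+ 2) * y - P) * (w * w * (½ * ½)) ∎
  where
  open ≡-Reasoning
  open ℚS.+-*-Solver

12pL≡3S+pK⇒L≡K/12+pS/4p² : ∀ (L K S : ℤ) p .{{_ : NonZero p}} →
  + 12 ℤ.* + p ℤ.* L ≡ + 3 ℤ.* S ℤ.+ + p ℤ.* K →
  fromℤ L ≡ K / 12 + fromℤ (+ p) * (fromℤ S * (+ 1 / p * (+ 1 / p) * (½ * ½)))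
12pL≡3S+pK⇒L≡K/12+pS/4p² L K S p eq = begin
  X                                  ≡⟨ ℚP.*-identityʳ X ⟨
  X * 1ℚ                             ≡⟨ cong (X *_) (n*1/n≡1 p) ⟨
  X * (P * w)                        ≡⟨ solve 3 (λ X P w → X :* (P :* w) := con (fromℤ (+ 12)) :* P :* X :* w :* con (+ 1 / 12)) refl X P w ⟩
  fromℤ (+ 12) * P * X * w * (+ 1 / 12) ≡⟨ cong (λ y → y * w * (+ 1 / 12)) eqℚ ⟩
  (fromℤ (+ 3) * S′ + P * K′) * w * (+ 1 / 12)
    ≡⟨ solve 4 (λ S P K w → (con (fromℤ (+ 3)) :* S :+ P :* K) :* w :* con (+ 1 / 12)
                        := K :* con (+ 1 / 12) :* (P :* w) :+ S :* w :* (con ½ :* con ½) :* con 1ℚ) refl S′ P K′ w ⟩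
  K′ * (+ 1 / 12) * (P * w) + S′ * w * (½ * ½) * 1ℚ
    ≡⟨ cong₂ (λ a b → K′ * (+ 1 / 12) * a + S′ * w * (½ * ½) * b) (n*1/n≡1 p) (sym (n*1/n≡1 p)) ⟩
  K′ * (+ 1 / 12) * 1ℚ + S′ * w * (½ * ½) * (P * w)
    ≡⟨ solve 4 (λ S P K w → K :* con (+ 1 / 12) :* con 1ℚ :+ S :* w :* (con ½ :* con ½) :* (P :* w)
                        := K :* con (+ 1 / 12) :+ P :* (S :* (w :* w :* (con ½ :* con ½)))) refl S′ P K′ w ⟩
  K′ * (+ 1 / 12) + P * (S′ * c)
    ≡⟨ cong (_+ P * (S′ * c)) (i/n≡i*1/n K 12) ⟨
  K / 12 + P * (S′ * c) ∎
  where
  open ≡-Reasoning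
  open ℚS.+-*-Solver
  X = fromℤ L
  P = fromℤ (+ p)
  w = + 1 / p
  S′ = fromℤ S
  K′ = fromℤ K
  c = w * w * (½ * ½)
  eqℚ : fromℤ (+ 12) * P * X ≡ fromℤ (+ 3) * S′ + P * K′
  eqℚ = begin
    fromℤ (+ 12) * P * X             ≡⟨ cong (_* X) (fromℤ-homo-* (+ 12) (+ p)) ⟨
    fromℤ (+ 12 ℤ.* + p) * X         ≡⟨ fromℤ-homo-* (+ 12 ℤ.* + p) L ⟨
    fromℤ (+ 12 ℤ.* + p ℤ.* L)       ≡⟨ cong fromℤ eq ⟩
    fromℤ (+ 3 ℤ.* S ℤ.+ + p ℤ.* K)   ≡⟨ fromℤ-homo-+ (+ 3 ℤ.* S) (+ p ℤ.* K) ⟩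
    fromℤ (+ 3 ℤ.* S) + fromℤ (+ p ℤ.* K) ≡⟨ cong₂ _+_ (fromℤ-homo-* (+ 3) S) (fromℤ-homo-* (+ p) K) ⟩
    fromℤ (+ 3) * S′ + P * K′        ∎

module BelowLine (n k : ℕ) where

  p q : ℕ
  p = suc n
  q = suc k

  quot res : ℕ → ℕ
  quot t = t ℕ.* q ℕ./ p
  res t = t ℕ.* q % p

  below : ℕ → ℕ → ℤ
  below r t = if t ℕ.* q <ᵇ r ℕ.* p then + t else + 0

  -- E t = 4p² B₁ (t / p) B₁ (tq / p) for 0 < t < p
  E G : ℕ → ℤ
  E t = (+ 2 ℤ.* + t ℤ.- + p) ℤ.* (+ 2 ℤ.* + res t ℤ.- + p)
  G t = + 6 ℤ.* + p ℤ.* + q ℤ.* (+ 2 ℤ.* + t) ℤ.+ ℤ.- (+ 2 ℤ.* + q) ℤ.* (+ 6 ℤ.* (+ t ℤ.* + t)) ℤ.+ ℤ.- (+ 3 ℤ.* (+ p ℤ.* + p))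

  K L : ℤ
  K = (+ p ℤ.- + 1) ℤ.* (+ 2 ℤ.* + p ℤ.* + q ℤ.- + 3 ℤ.* + p ℤ.+ + 2 ℤ.* + q)
  L = Σℤ 1 k (λ r → Σℤ 1 (r ℕ.* p) (below r))

  below-< : ∀ r t → t ℕ.* q < r ℕ.* p → below r t ≡ + t
  below-< r t tq<rp with t ℕ.* q <ᵇ r ℕ.* p in eq
  ... | true  = refl
  ... | false = contradiction (subst T eq (ℕP.<⇒<ᵇ tq<rp)) (λ ())

  below-≥ : ∀ r t → r ℕ.* p ≤ t ℕ.* q → below r t ≡ + 0
  below-≥ r t rp≤tq with t ℕ.* q <ᵇ r ℕ.* p in eq
  ... | true  = contradiction (ℕP.<ᵇ⇒< _ _ (subst T (sym eq) tt)) (ℕP.≤⇒≯ rp≤tq)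
  ... | false = refl

  below-vanishes : ∀ r t → r < q → p ≤ t → below r t ≡ + 0
  below-vanishes r t r<q p≤t = below-≥ r t (ℕP.<⇒≤ (begin-strict
    r ℕ.* p   <⟨ ℕP.*-monoˡ-< p r<q ⟩
    q ℕ.* p   ≡⟨ ℕP.*-comm q p ⟩
    p ℕ.* q   ≤⟨ ℕP.*-monoˡ-≤ q p≤t ⟩
    t ℕ.* q   ∎))
    where open ℕP.≤-Reasoning

  row-truncate : ∀ r → 0 < r → r < q → Σℤ 1 (r ℕ.* p) (below r) ≡ Σℤ 1 n (below r)
  row-truncate r@(suc r-1) _ r<q = begin
    Σℤ 1 (r ℕ.* p) (below r)                                ≡⟨ cong (λ m → Σℤ 1 m (below r)) (sym (ℕP.+-suc n (r-1 ℕ.* p))) ⟩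
    Σℤ 1 (n ℕ.+ suc (r-1 ℕ.* p)) (below r)                  ≡⟨ Σℤ-++ 1 n _ (below r) ⟩
    Σℤ 1 n (below r) ℤ.+ Σℤ p (suc (r-1 ℕ.* p)) (below r)   ≡⟨ cong (ℤ._+_ (Σℤ 1 n (below r))) (Σℤ-zero p (suc (r-1 ℕ.* p)) (λ t p≤t _ → below-vanishes r t r<q p≤t)) ⟩
    Σℤ 1 n (below r) ℤ.+ + 0                                ≡⟨ ℤP.+-identityʳ _ ⟩
    Σℤ 1 n (below r)                                        ∎
    where open ≡-Reasoning

  divmod : ∀ t → t ℕ.* q ≡ res t ℕ.+ quot t ℕ.* p
  divmod t = ℕD.m≡m%n+[m/n]*n (t ℕ.* q) p

  column-sum : ∀ t → t < p → Σℤ 1 k (λ r → below r t) ℤ.+ + t ℤ.* + quot t ≡ + k ℤ.* + t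
  column-sum t t<p = begin
    Σℤ 1 k col ℤ.+ + t ℤ.* + f                             ≡⟨ cong (λ m → Σℤ 1 m col ℤ.+ + t ℤ.* + f) (sym f+[k∸f]≡k) ⟩
    Σℤ 1 (f ℕ.+ (k ∸ f)) col ℤ.+ + t ℤ.* + f                ≡⟨ cong (ℤ._+ + t ℤ.* + f) (Σℤ-++ 1 f (k ∸ f) col) ⟩
    Σℤ 1 f col ℤ.+ Σℤ (suc f) (k ∸ f) col ℤ.+ + t ℤ.* + f   ≡⟨ cong₂ (λ x y → x ℤ.+ y ℤ.+ + t ℤ.* + f) under-line over-line ⟩
    + 0 ℤ.+ + (k ∸ f) ℤ.* + t ℤ.+ + t ℤ.* + f               ≡⟨ rearrange (+ (k ∸ f)) (+ t) (+ f) ⟩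
    + (f ℕ.+ (k ∸ f)) ℤ.* + t                               ≡⟨ cong (λ m → + m ℤ.* + t) f+[k∸f]≡k ⟩
    + k ℤ.* + t                                             ∎
    where
    open ≡-Reasoning
    col : ℕ → ℤ
    col r = below r t
    f = quot t
    f+[k∸f]≡k : f ℕ.+ (k ∸ f) ≡ k
    f+[k∸f]≡k = ℕP.m+[n∸m]≡n (ℕP.<⇒≤pred (ℕD.m<n*o⇒m/o<n (subst (t ℕ.* q <_) (ℕP.*-comm p q) (ℕP.*-monoˡ-< q t<p))))
    under-line : Σℤ 1 f col ≡ + 0
    under-line = Σℤ-zero 1 f (λ r _ r<1+f → below-≥ r t
      (ℕP.≤-trans (ℕP.*-monoˡ-≤ p (ℕP.<⇒≤pred r<1+f)) (ℕD.m/n*n≤m (t ℕ.* q) p)))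
    over-line : Σℤ (suc f) (k ∸ f) col ≡ + (k ∸ f) ℤ.* + t
    over-line = trans (Σℤ-cong (suc f) (k ∸ f) (λ r f<r _ → below-< r t (ℕP.<-≤-trans tq<[1+f]p (ℕP.*-monoˡ-≤ p f<r))))
                      (Σℤ-const (suc f) (k ∸ f) (+ t))
      where
      tq<[1+f]p : t ℕ.* q < suc f ℕ.* p
      tq<[1+f]p = subst (_< suc f ℕ.* p) (sym (divmod t)) (ℕP.+-monoˡ-< (f ℕ.* p) (ℕD.m%n<n (t ℕ.* q) p))
    rearrange : ∀ (x t f : ℤ) → + 0 ℤ.+ x ℤ.* t ℤ.+ t ℤ.* f ≡ (f ℤ.+ x) ℤ.* t
    rearrange = solve-∀

  B₁-/p : ∀ m → m % p ≢ 0 → B₁ (+ m / p) ≡ fromℤ (+ (m % p)) * (+ 1 / p) - ½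
  B₁-/p m m%p≢0 = trans (B₁-/ m p m%p≢0) (cong (_- ½) (i/n≡i*1/n (+ (m % p)) p))

  divmodℤ : ∀ t → + t ℤ.* + q ≡ + res t ℤ.+ + quot t ℤ.* + p
  divmodℤ t = begin
    + t ℤ.* + q                    ≡⟨ ℤP.pos-* t q ⟨
    + (t ℕ.* q)                    ≡⟨ cong +_ (divmod t) ⟩
    + res t ℤ.+ + (quot t ℕ.* p)   ≡⟨ cong (ℤ._+_ (+ res t)) (ℤP.pos-* (quot t) p) ⟩
    + res t ℤ.+ + quot t ℤ.* + p   ∎
    where open ≡-Reasoning

  lattice-sum≡L : sumFrom 1 k (λ r → sumFrom 1 (r ℕ.* p) (λ t → if t ℕ.* q <ᵇ r ℕ.* p then + t / 1 else 0ℚ)) ≡ fromℤ L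
  lattice-sum≡L = trans
    (sumFrom-cong 1 k (λ r _ _ → trans
      (sumFrom-cong 1 (r ℕ.* p) (λ t _ _ → sym (if-float fromℤ (t ℕ.* q <ᵇ r ℕ.* p))))
      (sumFrom-fromℤ 1 (r ℕ.* p) (below r))))
    (sumFrom-fromℤ 1 k (λ r → Σℤ 1 (r ℕ.* p) (below r)))

  L≡Σcolumns : L ≡ Σℤ 1 n (λ t → Σℤ 1 k (λ r → below r t))
  L≡Σcolumns = trans (Σℤ-cong 1 k (λ r 0<r r<q → row-truncate r 0<r r<q)) (Σℤ-swap 1 k 1 n below)

  ΣG≡pK : Σℤ 1 n G ≡ + p ℤ.* K
  ΣG≡pK = trans (Σℤ-quadratic n (+ 6 ℤ.* + p ℤ.* + q) (ℤ.- (+ 2 ℤ.* + q)) (ℤ.- (+ 3 ℤ.* (+ p ℤ.* + p)))) (closed-form (+ n) (+ k))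
    where
    closed-form : ∀ (N M : ℤ) →
      + 6 ℤ.* (+ 1 ℤ.+ N) ℤ.* (+ 1 ℤ.+ M) ℤ.* (N ℤ.* (N ℤ.+ + 1))
        ℤ.+ ℤ.- (+ 2 ℤ.* (+ 1 ℤ.+ M)) ℤ.* (N ℤ.* (N ℤ.+ + 1) ℤ.* (+ 2 ℤ.* N ℤ.+ + 1))
        ℤ.+ N ℤ.* ℤ.- (+ 3 ℤ.* ((+ 1 ℤ.+ N) ℤ.* (+ 1 ℤ.+ N)))
      ≡ (+ 1 ℤ.+ N) ℤ.* (((+ 1 ℤ.+ N) ℤ.- + 1)
          ℤ.* (+ 2 ℤ.* (+ 1 ℤ.+ N) ℤ.* (+ 1 ℤ.+ M) ℤ.- + 3 ℤ.* (+ 1 ℤ.+ N) ℤ.+ + 2 ℤ.* (+ 1 ℤ.+ M)))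
    closed-form = solve-∀

  module _ (coprime : Coprime p q) where

    res≢0 : ∀ t → 0 < t → t < p → res t ≢ 0
    res≢0 t 0<t t<p res≡0 = ℕP.<⇒≱ t<p (ℕDv.∣⇒≤ {{ℕ.>-nonZero 0<t}} p∣t)
      where
      p∣t : p ∣ t
      p∣t = ℕC.coprime-divisor coprime (subst (p ∣_) (ℕP.*-comm t q) (ℕDv.m%n≡0⇒n∣m (t ℕ.* q) p res≡0))

    res[p∸t]+res[t]≡p : ∀ t → 0 < t → t < p → res (p ∸ t) ℕ.+ res t ≡ p
    res[p∸t]+res[t]≡p t 0<t t<p = n∣m∧0<m<n+n⇒m≡n p∣sum 0<sum sum<p+p
      where
      p∸t+t≡p : p ∸ t ℕ.+ t ≡ p
      p∸t+t≡p = ℕP.m∸n+n≡m (ℕP.<⇒≤ t<p)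
      p∣sum : p ∣ res (p ∸ t) ℕ.+ res t
      p∣sum = ℕDv.m%n≡0⇒n∣m _ p (begin
        (res (p ∸ t) ℕ.+ res t) % p          ≡⟨ ℕD.%-distribˡ-+ ((p ∸ t) ℕ.* q) (t ℕ.* q) p ⟨
        ((p ∸ t) ℕ.* q ℕ.+ t ℕ.* q) % p      ≡⟨ cong (_% p) (ℕP.*-distribʳ-+ q (p ∸ t) t) ⟨
        ((p ∸ t ℕ.+ t) ℕ.* q) % p            ≡⟨ cong (λ m → m ℕ.* q % p) p∸t+t≡p ⟩
        (p ℕ.* q) % p                        ≡⟨ cong (_% p) (ℕP.*-comm p q) ⟩
        (q ℕ.* p) % p                        ≡⟨ ℕD.m*n%n≡0 q p ⟩
        0                                    ∎)
        where open ≡-Reasoning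
      0<sum : 0 < res (p ∸ t) ℕ.+ res t
      0<sum = ℕP.<-≤-trans (ℕP.n≢0⇒n>0 (res≢0 t 0<t t<p)) (ℕP.m≤n+m (res t) (res (p ∸ t)))
      sum<p+p : res (p ∸ t) ℕ.+ res t < p ℕ.+ p
      sum<p+p = ℕP.+-mono-< (ℕD.m%n<n ((p ∸ t) ℕ.* q) p) (ℕD.m%n<n (t ℕ.* q) p)

    Σres≡Σid : Σℤ 1 n (λ t → + res t) ≡ Σℤ 1 n (λ t → + t)
    Σres≡Σid = ℤP.*-cancelˡ-≡ (+ 2) _ _ (trans
      (Σℤ-complement n (λ t → + res t) (+ p) (λ t 0<t t<p → cong +_ (res[p∸t]+res[t]≡p t 0<t t<p)))
      (sym (Σℤ-complement n (λ t → + t) (+ p) (λ t _ t<p → cong +_ (ℕP.m∸n+n≡m (ℕP.<⇒≤ t<p))))))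

    12pL≡3ΣE+pK : + 12 ℤ.* + p ℤ.* L ≡ + 3 ℤ.* Σℤ 1 n E ℤ.+ + p ℤ.* K
    12pL≡3ΣE+pK = ∙-cancelʳ (+ 6 ℤ.* + p ℤ.* S₁) _ _ (begin
      + 12 ℤ.* + p ℤ.* L ℤ.+ + 6 ℤ.* + p ℤ.* S₁
        ≡⟨ cong (λ x → + 12 ℤ.* + p ℤ.* x ℤ.+ + 6 ℤ.* + p ℤ.* S₁) L≡Σcolumns ⟩
      + 12 ℤ.* + p ℤ.* Σℤ 1 n C ℤ.+ + 6 ℤ.* + p ℤ.* S₁
        ≡⟨ cong (ℤ._+ + 6 ℤ.* + p ℤ.* S₁) (Σℤ-*ˡ 1 n (+ 12 ℤ.* + p) C) ⟨
      Σℤ 1 n (λ t → + 12 ℤ.* + p ℤ.* C t) ℤ.+ + 6 ℤ.* + p ℤ.* S₁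
        ≡⟨ Σℤ-+-*ˡ 1 n (λ t → + 12 ℤ.* + p ℤ.* C t) (+ 6 ℤ.* + p) (λ t → + t) ⟨
      Σℤ 1 n (λ t → + 12 ℤ.* + p ℤ.* C t ℤ.+ + 6 ℤ.* + p ℤ.* + t)
        ≡⟨ Σℤ-cong 1 n (λ t _ t<p → column-identity (+ p) (+ k) (+ t) (+ quot t) (+ res t) (C t) (column-sum t t<p) (divmodℤ t)) ⟩
      Σℤ 1 n (λ t → + 3 ℤ.* E t ℤ.+ G t ℤ.+ + 6 ℤ.* + p ℤ.* + res t)
        ≡⟨ Σℤ-+-*ˡ 1 n (λ t → + 3 ℤ.* E t ℤ.+ G t) (+ 6 ℤ.* + p) (λ t → + res t) ⟩
      Σℤ 1 n (λ t → + 3 ℤ.* E t ℤ.+ G t) ℤ.+ + 6 ℤ.* + p ℤ.* Σℤ 1 n (λ t → + res t)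
        ≡⟨ cong₂ (λ x y → x ℤ.+ + 6 ℤ.* + p ℤ.* y) (Σℤ-+ 1 n (λ t → + 3 ℤ.* E t) G) Σres≡Σid ⟩
      Σℤ 1 n (λ t → + 3 ℤ.* E t) ℤ.+ Σℤ 1 n G ℤ.+ + 6 ℤ.* + p ℤ.* S₁
        ≡⟨ cong₂ (λ x y → x ℤ.+ y ℤ.+ + 6 ℤ.* + p ℤ.* S₁) (Σℤ-*ˡ 1 n (+ 3) E) ΣG≡pK ⟩
      + 3 ℤ.* Σℤ 1 n E ℤ.+ + p ℤ.* K ℤ.+ + 6 ℤ.* + p ℤ.* S₁ ∎)
      where
      open ≡-Reasoning
      C : ℕ → ℤ
      C t = Σℤ 1 k (λ r → below r t)
      S₁ = Σℤ 1 n (λ t → + t)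

    dedekind≡ΣE/4p² : dedekind (+ q) p ≡ fromℤ (Σℤ 1 n E) * (+ 1 / p * (+ 1 / p) * (½ * ½))
    dedekind≡ΣE/4p² = begin
      sumFrom 1 n (λ r → B₁ (+ r / p) * B₁ ((+ r ℤ.* + q) / p))   ≡⟨ sumFrom-cong 1 n term ⟩
      sumFrom 1 n (λ r → fromℤ (E r) * c)                        ≡⟨ sumFrom-*ʳ 1 n (fromℤ ∘ E) c ⟩
      sumFrom 1 n (fromℤ ∘ E) * c                                ≡⟨ cong (_* c) (sumFrom-fromℤ 1 n E) ⟩
      fromℤ (Σℤ 1 n E) * c                                       ∎
      where
      open ≡-Reasoning
      w = + 1 / p
      c = w * w * (½ * ½)
      fromℤ-2i-j : ∀ i j → fromℤ (+ 2 ℤ.* i ℤ.- j) ≡ fromℤ (+ 2) * fromℤ i - fromℤ j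
      fromℤ-2i-j i j = trans (fromℤ-homo-- (+ 2 ℤ.* i) j) (cong (_- fromℤ j) (fromℤ-homo-* (+ 2) i))
      term : ∀ r → 1 ≤ r → r < 1 ℕ.+ n → B₁ (+ r / p) * B₁ ((+ r ℤ.* + q) / p) ≡ fromℤ (E r) * c
      term r 0<r r<p = begin
        B₁ (+ r / p) * B₁ ((+ r ℤ.* + q) / p)
          ≡⟨ cong (λ i → B₁ (+ r / p) * B₁ (i / p)) (ℤP.pos-* r q) ⟨
        B₁ (+ r / p) * B₁ (+ (r ℕ.* q) / p)
          ≡⟨ cong₂ _*_ B₁[r/p] (B₁-/p (r ℕ.* q) (res≢0 r 0<r r<p)) ⟩
        (fromℤ (+ r) * w - ½) * (fromℤ (+ res r) * w - ½)
          ≡⟨ B₁-product (fromℤ (+ r)) (fromℤ (+ res r)) (fromℤ (+ p)) w (n*1/n≡1 p) ⟩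
        (fromℤ (+ 2) * fromℤ (+ r) - fromℤ (+ p)) * (fromℤ (+ 2) * fromℤ (+ res r) - fromℤ (+ p)) * c
          ≡⟨ cong (_* c) (trans (fromℤ-homo-* (+ 2 ℤ.* + r ℤ.- + p) (+ 2 ℤ.* + res r ℤ.- + p)) (cong₂ _*_ (fromℤ-2i-j (+ r) (+ p)) (fromℤ-2i-j (+ res r) (+ p)))) ⟨
        fromℤ (E r) * c ∎
        where
        r%p≡r : r % p ≡ r
        r%p≡r = ℕD.m<n⇒m%n≡m r<p
        B₁[r/p] : B₁ (+ r / p) ≡ fromℤ (+ r) * w - ½
        B₁[r/p] = trans (B₁-/p r (λ r%p≡0 → ℕP.<⇒≢ 0<r (sym (trans (sym r%p≡r) r%p≡0))))
                        (cong (λ m → fromℤ (+ m) * w - ½) r%p≡r)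

lemma1 : (p q : ℕ) → .{{_ : NonZero p}} → .{{_ : NonZero q}} → Coprime p q →
    sumFromTo 1 (q ℕ.∸ 1)
      (λ r → sumFromTo 1 (r ℕ.* p)
        (λ t → if t ℕ.* q <ᵇ r ℕ.* p then + t / 1 else 0ℚ))
      ≡ ((+ p ℤ.- + 1) ℤ.* (+ 2 ℤ.* + p ℤ.* + q ℤ.- + 3 ℤ.* + p ℤ.+ + 2 ℤ.* + q)) / 12
        + (+ p / 1) * dedekind (+ q) p
lemma1 (suc n) (suc k) coprime = begin
  sumFrom 1 k (λ r → sumFrom 1 (r ℕ.* p) (λ t → if t ℕ.* q <ᵇ r ℕ.* p then + t / 1 else 0ℚ))
    ≡⟨ lattice-sum≡L ⟩
  fromℤ L
    ≡⟨ 12pL≡3S+pK⇒L≡K/12+pS/4p² L K (Σℤ 1 n E) p (12pL≡3ΣE+pK coprime) ⟩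
  K / 12 + fromℤ (+ p) * (fromℤ (Σℤ 1 n E) * (+ 1 / p * (+ 1 / p) * (½ * ½)))
    ≡⟨ cong (λ x → K / 12 + fromℤ (+ p) * x) (dedekind≡ΣE/4p² coprime) ⟨
  K / 12 + fromℤ (+ p) * dedekind (+ q) p ∎
  where
  open BelowLine n k
  open ≡-Reasoning
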